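{- Given positive integers $r,m$ with $r\ge m$, there is a split graph $G$ (in particular a chordal graph) with $|V(G)|\ge r-m+1$ such that $\sigma(G,m,r)=r-m+1$.
   Context: The game $\mathrm{RS}(G,m,r,s)$ is played on a finite graph $G$ by $r$ revolutionaries and $s$ spies. First each revolutionary occupies a vertex, then each spy occupies a vertex (several players may share a vertex). In each subsequent round, each revolutionary may move to an adjacent vertex or stay put, and then each spy may move to an adjacent vertex or stay put; all positions are known to all players. The revolutionaries win if at the end of some round (the initial placement counts as a round) some vertex holds at least $m$ revolutionaries and no spy; the spies win if this never happens. $\sigma(G,m,r)$ denotes the minimum $s$ such that the spies have a winning strategy in $\mathrm{RS}(G,m,r,s)$. A split graph is a graph whose vertex set can be partitioned into a clique and an independent set. -}

module Defs where

open import Data.Nat using (ℕ; zero; suc; _≥_; _<_)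
open import Data.Fin using (Fin; _≟_)
open import Data.Bool using (Bool; T)
open import Data.List using (List; []; _∷_; length; filter; allFin)
open import Data.List.Base using (applyUpTo)
open import Data.Product using (Σ; ∃; _×_; _,_)
open import Data.Sum using (_⊎_)
open import Relation.Nullary using (¬_)
open import Relation.Binary.PropositionalEquality using (_≡_)

record Graph (n : ℕ) : Set where
  field
    adj    : Fin n → Fin n → Bool
    sym    : ∀ u v → T (adj u v) → T (adj v u)
    irrefl : ∀ v → ¬ T (adj v v)
open Graph public

IsSplit : ∀ {n} → Graph n → Set
IsSplit {n} G = Σ (Fin n → Bool) λ inK →
    (∀ u v → T (inK u) → T (inK v) → ¬ u ≡ v → T (adj G u v))
  × (∀ u v → ¬ T (inK u) → ¬ T (inK v) → ¬ T (adj G u v))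

Config : ℕ → ℕ → Set
Config n k = Fin k → Fin n

Step : ∀ {n} → Graph n → Fin n → Fin n → Set
Step G u v = u ≡ v ⊎ T (adj G u v)

LegalMove : ∀ {n k} → Graph n → Config n k → Config n k → Set
LegalMove G c c' = ∀ i → Step G (c i) (c' i)

countAt : ∀ {n k} → Config n k → Fin n → ℕ
countAt {k = k} c v = length (filter (λ i → c i ≟ v) (allFin k))

RevsWinRound : ∀ {n r s} → ℕ → Config n r → Config n s → Set
RevsWinRound {n} {r} {s} m R S =
  ∃ λ (v : Fin n) → countAt R v ≥ m × (∀ (j : Fin s) → ¬ S j ≡ v)

LegalRevPlay : ∀ {n r} → Graph n → (ℕ → Config n r) → Set
LegalRevPlay G R = ∀ t → LegalMove G (R t) (R (suc t))

history : ∀ {n r} → (ℕ → Config n r) → ℕ → List (Config n r)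
history R t = applyUpTo R (suc t)

-- A (deterministic) spy strategy: given the list of revolutionary
-- configurations so far (R 0 … R t; the spies' own previous positions are
-- determined by it), the spies' configuration at the end of round t.
SpyStrategy : ℕ → ℕ → ℕ → Set
SpyStrategy n r s = List (Config n r) → Config n s

-- The spies' winning condition for a strategy: against every legal play of
-- the revolutionaries, the spies' responses are legal moves and the
-- revolutionaries never win a round.  (Quantifying over all legal
-- revolutionary move sequences is the same as quantifying over all
-- adaptive revolutionary strategies, since the spy strategy is fixed.)
WinningSpyStrategy : ∀ {n} → Graph n → (m r s : ℕ) → SpyStrategy n r s → Set
WinningSpyStrategy G m r s f =
  ∀ (R : ℕ → Config _ r) → LegalRevPlay G R →
    (∀ t → LegalMove G (f (history R t)) (f (history R (suc t))))
  × (∀ t → ¬ RevsWinRound m (R t) (f (history R t)))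

SpiesWin : ∀ {n} → Graph n → (m r s : ℕ) → Set
SpiesWin G m r s = Σ (SpyStrategy _ r s) (WinningSpyStrategy G m r s)

SigmaIs : ∀ {n} → Graph n → (m r k : ℕ) → Set
SigmaIs G m r k = SpiesWin G m r k × (∀ s → s < k → ¬ SpiesWin G m r s)

module Submission where

-- For 1 ≤ m ≤ r let G be the split graph with a clique K of r vertices and, for
-- every subset U of K, r independent vertices whose neighbourhood is exactly U.
-- Then σ(G, m, r) = k where k = r ∸ m + 1.
--
-- Upper bound (any graph): k spies shadowing the first k revolutionaries win,
-- since an unguarded vertex holds only the r ∸ k = m ∸ 1 unshadowed ones.
-- Lower bound: s < k spies lose.  The revolutionaries start on K; the set U of
-- unguarded clique vertices has at least r ∸ s ≥ m elements, some copy u of U is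
-- unguarded too, and the revolutionaries on U step to u.  A spy could reach u
-- only from u or from U, where there were none.

open import Defs hiding (sym; irrefl)
open import Data.Nat using (ℕ; zero; suc; _+_; _*_; _^_; _∸_; _≤_; _≥_; _<_; z≤n; s≤s; s≤s⁻¹; _<?_)
open import Data.Nat.Properties
  using (≤-trans; ≤-reflexive; ≤-<-trans; +-mono-≤; +-monoʳ-≤; +-suc; +-comm; m≤m+n;
         ∸-monoʳ-≤; ∸-monoʳ-<; ∸-+-assoc; m∸[m∸n]≡n; m∸n+n≡m; m<1+n⇒m≤n;
         <⇒≱; ≮⇒≥; module ≤-Reasoning)
open import Data.Fin as Fin
  using (Fin; toℕ; _↑ˡ_; _↑ʳ_; splitAt; join; inject≤; fromℕ<; combine; quotient;
         finToFun; funToFin; _≟_)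
open import Data.Fin.Properties
  using (toℕ-injective; toℕ-inject≤; toℕ-fromℕ<; splitAt-↑ˡ; splitAt-↑ʳ; join-splitAt;
         ↑ˡ-injective; ↑ʳ-injective; combine-injectiveʳ; remQuot-combine;
         finToFun-funToFin; 2↔Bool; any?)
open import Data.Fin.Subset
  using (Subset; inside; outside; ⁅_⁆; _∪_; ∁; ∣_∣; _∈_; Nonempty)
  renaming (⊥ to ∅)
open import Data.Fin.Subset.Properties
  using (∣p∣≤n; ∣p∣≤∣x∷p∣; ∣⊥∣≡0; ∣⁅x⁆∣≡1; p⊆q⇒∣p∣≤∣q∣; ∣∁p∣≡n∸∣p∣; x∈⁅x⁆; x∈p∪q⁺;
         x∈∁p⇒x∉p; nonempty?; Empty-unique; _∈?_)
open import Data.Vec using ([]; _∷_; tabulate; lookup; here; there)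
open import Data.Vec.Properties
  using (lookup∘tabulate; tabulate-cong; tabulate∘lookup; []=⇒lookup; lookup⇒[]=)
open import Data.List using (length; filter; last) renaming ([] to []ᴸ; _∷_ to _∷ᴸ_)
import Data.List as List
open import Data.Maybe using (Maybe; just; nothing; maybe′)
open import Data.Bool using (Bool; true; false; T)
open import Data.Sum using (_⊎_; inj₁; inj₂; [_,_]′)
open import Data.Product using (Σ; ∃; _×_; _,_; proj₁; proj₂)
open import Data.Empty using (⊥-elim)
open import Data.Unit using (tt)
open import Function using (_∘_; const)
open import Function.Bundles using (Inverse)
open import Function.Definitions using (Injective)
open import Relation.Nullary using (¬_; Dec; yes; no; does; proof; ¬?)
open import Relation.Nullary.Reflects using (Reflects; invert)
open import Relation.Nullary.Decidable using (⌊_⌋; toWitness; fromWitness; dec-true)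
open import Relation.Unary using (Pred; Decidable)
open import Relation.Binary.PropositionalEquality
  using (_≡_; _≢_; refl; sym; trans; cong; subst; subst₂; ≢-sym; module ≡-Reasoning)

∣p∪q∣≤∣p∣+∣q∣ : ∀ {n} (p q : Subset n) → ∣ p ∪ q ∣ ≤ ∣ p ∣ + ∣ q ∣
∣p∪q∣≤∣p∣+∣q∣ []            []            = z≤n
∣p∪q∣≤∣p∣+∣q∣ (outside ∷ p) (outside ∷ q) = ∣p∪q∣≤∣p∣+∣q∣ p q
∣p∪q∣≤∣p∣+∣q∣ (outside ∷ p) (inside  ∷ q) =
  ≤-trans (s≤s (∣p∪q∣≤∣p∣+∣q∣ p q)) (≤-reflexive (sym (+-suc ∣ p ∣ ∣ q ∣)))
∣p∪q∣≤∣p∣+∣q∣ (inside  ∷ p) (x       ∷ q) =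
  s≤s (≤-trans (∣p∪q∣≤∣p∣+∣q∣ p q) (+-monoʳ-≤ ∣ p ∣ (∣p∣≤∣x∷p∣ x q)))

∣p∣≤n∸k : ∀ {n} k (p : Subset n) → (∀ {i} → i ∈ p → k ≤ toℕ i) → ∣ p ∣ ≤ n ∸ k
∣p∣≤n∸k zero    p             _     = ∣p∣≤n p
∣p∣≤n∸k (suc k) []            _     = z≤n
∣p∣≤n∸k (suc k) (outside ∷ p) large = ∣p∣≤n∸k k p (λ i∈p → s≤s⁻¹ (large (there i∈p)))
∣p∣≤n∸k (suc k) (inside  ∷ p) large with large here
... | ()

∣p∣>0⇒Nonempty : ∀ {n} (p : Subset n) → 0 < ∣ p ∣ → Nonempty p
∣p∣>0⇒Nonempty {n} p 0<∣p∣ with nonempty? p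
... | yes nonempty = nonempty
... | no  empty    =
  ⊥-elim (<⇒≱ 0<∣p∣ (≤-reflexive (trans (cong ∣_∣ (Empty-unique empty)) (∣⊥∣≡0 n))))

at : ∀ {n k} → Config n k → Fin n → Subset k
at c v = tabulate (λ i → does (c i ≟ v))

∈-at⁻ : ∀ {n k} {c : Config n k} {v i} → i ∈ at c v → c i ≡ v
∈-at⁻ {c = c} {v} {i} i∈ =
  invert (subst (Reflects _) answer-yes (proof (c i ≟ v)))
  where
  answer-yes : does (c i ≟ v) ≡ true
  answer-yes = trans (sym (lookup∘tabulate _ i)) ([]=⇒lookup i∈)

∈-at⁺ : ∀ {n k} {c : Config n k} {v i} → c i ≡ v → i ∈ at c v
∈-at⁺ {c = c} {v} {i} ci≡v =
  lookup⇒[]= i _ (trans (lookup∘tabulate _ i) (dec-true (c i ≟ v) ci≡v))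

length-filter-tabulate : ∀ {ℓ n} {A : Set} {P : Pred A ℓ} (P? : Decidable P) (g : Fin n → A) →
  length (filter P? (List.tabulate g)) ≡ ∣ tabulate (λ i → does (P? (g i))) ∣
length-filter-tabulate {n = zero}  P? g = refl
length-filter-tabulate {n = suc n} P? g with does (P? (g Fin.zero))
... | true  = cong suc (length-filter-tabulate P? (g ∘ Fin.suc))
... | false = length-filter-tabulate P? (g ∘ Fin.suc)

countAt≡∣at∣ : ∀ {n k} (c : Config n k) v → countAt c v ≡ ∣ at c v ∣
countAt≡∣at∣ c v = length-filter-tabulate (λ i → c i ≟ v) (λ i → i)

hits : ∀ {s r} → (Fin s → Maybe (Fin r)) → Subset r
hits {zero}  h = ∅
hits {suc s} h = maybe′ ⁅_⁆ ∅ (h Fin.zero) ∪ hits (h ∘ Fin.suc)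

∣hits∣≤s : ∀ {s r} (h : Fin s → Maybe (Fin r)) → ∣ hits h ∣ ≤ s
∣hits∣≤s {zero}  {r} h = ≤-reflexive (∣⊥∣≡0 r)
∣hits∣≤s {suc s} {r} h =
  ≤-trans (∣p∪q∣≤∣p∣+∣q∣ (maybe′ ⁅_⁆ ∅ (h Fin.zero)) (hits (h ∘ Fin.suc)))
          (+-mono-≤ (∣single∣≤1 (h Fin.zero)) (∣hits∣≤s (h ∘ Fin.suc)))
  where
  ∣single∣≤1 : (a : Maybe (Fin r)) → ∣ maybe′ ⁅_⁆ ∅ a ∣ ≤ 1
  ∣single∣≤1 nothing  = ≤-trans (≤-reflexive (∣⊥∣≡0 r)) z≤n
  ∣single∣≤1 (just x) = ≤-reflexive (∣⁅x⁆∣≡1 x)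

hit : ∀ {s r} (h : Fin s → Maybe (Fin r)) j {c} → h j ≡ just c → c ∈ hits h
hit h Fin.zero    {c} h₀≡c rewrite h₀≡c =
  x∈p∪q⁺ {p = ⁅ c ⁆} {q = hits (h ∘ Fin.suc)} (inj₁ (x∈⁅x⁆ c))
hit h (Fin.suc j) {c} hj≡c =
  x∈p∪q⁺ {p = maybe′ ⁅_⁆ ∅ (h Fin.zero)} (inj₂ (hit (h ∘ Fin.suc) j hj≡c))

slotOf : ∀ {n r} → (Fin r → Fin n) → Fin n → Maybe (Fin r)
slotOf slot w with any? (λ c → slot c ≟ w)
... | yes (c , _) = just c
... | no  _       = nothing

slotOf-slot : ∀ {n r} {slot : Fin r → Fin n} → Injective _≡_ _≡_ slot →
  ∀ c → slotOf slot (slot c) ≡ just c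
slotOf-slot {slot = slot} slot-injective c with any? (λ c′ → slot c′ ≟ slot c)
... | yes (c′ , same) = cong just (slot-injective same)
... | no  none        = ⊥-elim (none (c , refl))

-- The slots (r distinct vertices) on which no spy of S stands.  There are at
-- least r ∸ s of them, since each of the s spies occupies at most one slot.
vacant : ∀ {n r s} → (Fin r → Fin n) → Config n s → Subset r
vacant slot S = ∁ (hits (slotOf slot ∘ S))

∣vacant∣≥r∸s : ∀ {n r s} (slot : Fin r → Fin n) (S : Config n s) → r ∸ s ≤ ∣ vacant slot S ∣
∣vacant∣≥r∸s {r = r} {s} slot S =
  subst (r ∸ s ≤_) (sym (∣∁p∣≡n∸∣p∣ occupied)) (∸-monoʳ-≤ r (∣hits∣≤s (slotOf slot ∘ S)))
  where
  occupied : Subset r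
  occupied = hits (slotOf slot ∘ S)

vacant-unoccupied : ∀ {n r s} {slot : Fin r → Fin n} {S : Config n s} →
  Injective _≡_ _≡_ slot → ∀ {c} → c ∈ vacant slot S → ∀ j → S j ≢ slot c
vacant-unoccupied {slot = slot} {S} slot-injective {c} c∈vacant j Sj≡slot =
  x∈∁p⇒x∉p c∈vacant (hit (slotOf slot ∘ S) j S-hits-c)
  where
  S-hits-c : slotOf slot (S j) ≡ just c
  S-hits-c = trans (cong (slotOf slot) Sj≡slot) (slotOf-slot slot-injective c)

last-history : ∀ {n r} (R : ℕ → Config n r) t → last (history R t) ≡ just (R t)
last-history R zero    = refl
last-history R (suc t) = last-history (R ∘ suc) t

-- Spy j stands where revolutionary j stood at the end of the last round
-- (`default` is only used on the empty history, which never occurs).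
shadowing : ∀ {n r k} → Config n k → k ≤ r → SpyStrategy n r k
shadowing default k≤r history = maybe′ (λ R j → R (inject≤ j k≤r)) default (last history)

-- On any graph, k ≤ r shadowing spies win as soon as r ∸ k < m: a vertex without
-- spies holds only revolutionaries numbered k or more, and there are r ∸ k of those.
shadowing-wins : ∀ {n r k m} (G : Graph n) (default : Config n k) (k≤r : k ≤ r) → r ∸ k < m →
  WinningSpyStrategy G m r k (shadowing default k≤r)
shadowing-wins {r = r} {k} {m} G default k≤r r∸k<m R R-legal = follows , never-outnumbered
  where
  spy-position : ∀ t j → shadowing default k≤r (history R t) j ≡ R t (inject≤ j k≤r)
  spy-position t j rewrite last-history R t = refl

  follows : ∀ t → LegalMove G (shadowing default k≤r (history R t))
                             (shadowing default k≤r (history R (suc t)))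
  follows t j = subst₂ (Step G) (sym (spy-position t j)) (sym (spy-position (suc t) j))
                       (R-legal t (inject≤ j k≤r))

  shadowed : ∀ {i : Fin r} (i<k : toℕ i < k) → inject≤ (fromℕ< i<k) k≤r ≡ i
  shadowed i<k = toℕ-injective (trans (toℕ-inject≤ _ k≤r) (toℕ-fromℕ< i<k))

  never-outnumbered : ∀ t → ¬ RevsWinRound m (R t) (shadowing default k≤r (history R t))
  never-outnumbered t (v , m≤count , unguarded) = <⇒≱ (≤-<-trans few r∸k<m) m≤count
    where
    unshadowed : ∀ {i} → i ∈ at (R t) v → k ≤ toℕ i
    unshadowed {i} i∈ with toℕ i <? k
    ... | no  i≮k = ≮⇒≥ i≮k
    ... | yes i<k = ⊥-elim (unguarded (fromℕ< i<k)
            (trans (spy-position t _) (trans (cong (R t) (shadowed i<k)) (∈-at⁻ {c = R t} i∈))))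
    few : countAt (R t) v ≤ r ∸ k
    few = subst (_≤ r ∸ k) (sym (countAt≡∣at∣ (R t) v)) (∣p∣≤n∸k k (at (R t) v) unshadowed)

record Gathering {n} (G : Graph n) (r : ℕ) : Set where
  field
    home           : Fin r → Fin n
    home-injective : Injective _≡_ _≡_ home
    meet           : Subset r → Fin r → Fin n
    meet-injective : ∀ U → Injective _≡_ _≡_ (meet U)
    home-meet      : ∀ U c {i} → i ∈ U → T (adj G (home i) (meet U c))
    meet-neighbour : ∀ U c w → T (adj G w (meet U c)) → ∃ λ i → i ∈ U × w ≡ home i

-- The
-- revolutionaries start at the homes; the unguarded homes U number at least
-- r ∸ s ≥ m, some meeting point of U is unguarded as well, and in round 1 the
-- revolutionaries on U step onto it.  A spy reaching it would have come from it
-- or from a home in U, and no spy stood there.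
gathering-beats-spies : ∀ {n r m s} {G : Graph n} → Gathering G r → 1 ≤ m → m ≤ r ∸ s →
  ¬ SpiesWin G m r s
gathering-beats-spies {n} {r} {m} {s} {G} gathering 1≤m m≤r∸s (f , win) =
  proj₂ (win R R-legal) 1 (point , gathered , unguarded)
  where
  open Gathering gathering

  S₀ : Config n s
  S₀ = f (home ∷ᴸ []ᴸ)

  U : Subset r
  U = vacant home S₀

  point-vacant : Nonempty (vacant (meet U) S₀)
  point-vacant = ∣p∣>0⇒Nonempty _ (≤-trans (≤-trans 1≤m m≤r∸s) (∣vacant∣≥r∸s (meet U) S₀))

  point : Fin n
  point = meet U (proj₁ point-vacant)

  move : ∀ i → Dec (i ∈ U) → Fin n
  move i (yes _) = point
  move i (no  _) = home i

  move-legal : ∀ i d → Step G (home i) (move i d)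
  move-legal i (yes i∈U) = inj₂ (home-meet U _ i∈U)
  move-legal i (no  _)   = inj₁ refl

  move-gathers : ∀ i d → i ∈ U → move i d ≡ point
  move-gathers i (yes _)   _   = refl
  move-gathers i (no  i∉U) i∈U = ⊥-elim (i∉U i∈U)

  R : ℕ → Config n r
  R zero    = home
  R (suc _) = λ i → move i (i ∈? U)

  R-legal : LegalRevPlay G R
  R-legal zero    i = move-legal i (i ∈? U)
  R-legal (suc _) i = inj₁ refl

  U-at-point : ∀ {i} → i ∈ U → i ∈ at (R 1) point
  U-at-point {i} i∈U = ∈-at⁺ {c = R 1} (move-gathers i (i ∈? U) i∈U)

  gathered : m ≤ countAt (R 1) point
  gathered = begin
    m                   ≤⟨ m≤r∸s ⟩
    r ∸ s               ≤⟨ ∣vacant∣≥r∸s home S₀ ⟩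
    ∣ U ∣               ≤⟨ p⊆q⇒∣p∣≤∣q∣ U-at-point ⟩
    ∣ at (R 1) point ∣  ≡⟨ sym (countAt≡∣at∣ (R 1) point) ⟩
    countAt (R 1) point ∎
    where open ≤-Reasoning

  unguarded : ∀ j → ¬ f (history R 1) j ≡ point
  unguarded j S₁j≡point with proj₁ (win R R-legal) 0 j
  ... | inj₁ stayed =
    vacant-unoccupied (meet-injective U) (proj₂ point-vacant) j (trans stayed S₁j≡point)
  ... | inj₂ moved
    with meet-neighbour U _ (S₀ j) (subst (λ w → T (adj G (S₀ j) w)) S₁j≡point moved)
  ... | i , i∈U , S₀j≡home = vacant-unoccupied home-injective i∈U j S₀j≡home

-- Subsets of Fin r are coded by the numbers below 2 ^ r (their bit vectors).
decode : ∀ {r} → Fin (2 ^ r) → Subset r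
decode {r} x = tabulate (Inverse.to 2↔Bool ∘ finToFun {2} {r} x)

encode : ∀ {r} → Subset r → Fin (2 ^ r)
encode U = funToFin (Inverse.from 2↔Bool ∘ lookup U)

decode-encode : ∀ {r} (U : Subset r) → decode (encode U) ≡ U
decode-encode U = begin
  tabulate (to ∘ finToFun (funToFin (from ∘ lookup U)))
    ≡⟨ tabulate-cong (λ i → cong to (finToFun-funToFin (from ∘ lookup U) i)) ⟩
  tabulate (to ∘ from ∘ lookup U)
    ≡⟨ tabulate-cong (λ i → strictlyInverseˡ (lookup U i)) ⟩
  tabulate (lookup U)
    ≡⟨ tabulate∘lookup U ⟩
  U ∎
  where
  open ≡-Reasoning
  open Inverse 2↔Bool using (to; from; strictlyInverseˡ)

-- The split graph on Fin (a + b) with clique Fin a (the first a vertices) and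
-- independent set Fin b, the independent vertex y being adjacent to the clique
-- vertices in nb y.
module SplitGraph {a b : ℕ} (nb : Fin b → Subset a) where

  link : Fin a ⊎ Fin b → Fin a ⊎ Fin b → Bool
  link (inj₁ i) (inj₁ j) = ⌊ ¬? (i ≟ j) ⌋
  link (inj₁ i) (inj₂ y) = ⌊ i ∈? nb y ⌋
  link (inj₂ y) (inj₁ i) = ⌊ i ∈? nb y ⌋
  link (inj₂ _) (inj₂ _) = false

  link-sym : ∀ x y → T (link x y) → T (link y x)
  link-sym (inj₁ i) (inj₁ j) t = fromWitness (≢-sym (toWitness t))
  link-sym (inj₁ _) (inj₂ _) t = t
  link-sym (inj₂ _) (inj₁ _) t = t

  link-irrefl : ∀ x → ¬ T (link x x)
  link-irrefl (inj₁ i) t = toWitness t refl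

  graph : Graph (a + b)
  graph = record
    { adj    = λ u v → link (splitAt a u) (splitAt a v)
    ; sym    = λ u v → link-sym (splitAt a u) (splitAt a v)
    ; irrefl = λ v → link-irrefl (splitAt a v)
    }

  isClique : Fin a ⊎ Fin b → Bool
  isClique = [ const true , const false ]′

  link-clique : ∀ x y → T (isClique x) → T (isClique y) → x ≢ y → T (link x y)
  link-clique (inj₁ i) (inj₁ j) _ _ x≢y = fromWitness (λ i≡j → x≢y (cong inj₁ i≡j))

  link-independent : ∀ x y → ¬ T (isClique x) → ¬ T (isClique y) → ¬ T (link x y)
  link-independent (inj₁ _) _        x∉K _   _ = x∉K tt
  link-independent (inj₂ _) (inj₁ _) _   y∉K _ = y∉K tt

  splitAt-injective : ∀ {u v} → splitAt a u ≡ splitAt a v → u ≡ v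
  splitAt-injective {u} {v} same =
    trans (sym (join-splitAt a b u)) (trans (cong (join a b) same) (join-splitAt a b v))

  isSplit : IsSplit graph
  isSplit = isClique ∘ splitAt a
          , (λ u v u∈K v∈K u≢v → link-clique _ _ u∈K v∈K (u≢v ∘ splitAt-injective))
          , (λ u v → link-independent (splitAt a u) (splitAt a v))

  clique : Fin a → Fin (a + b)
  clique i = i ↑ˡ b

  independent : Fin b → Fin (a + b)
  independent y = a ↑ʳ y

  clique-independent : ∀ {i y} → i ∈ nb y → T (adj graph (clique i) (independent y))
  clique-independent {i} {y} i∈ rewrite splitAt-↑ˡ a i b | splitAt-↑ʳ a b y = fromWitness i∈

  independent-neighbour : ∀ w y → T (adj graph w (independent y)) →
    ∃ λ i → i ∈ nb y × w ≡ clique i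
  independent-neighbour w y adjacent rewrite splitAt-↑ʳ a b y with splitAt a w in eq
  ... | inj₁ i = i , toWitness adjacent , splitAt-injective (trans eq (sym (splitAt-↑ˡ a i b)))

-- The split graph for r revolutionaries: a clique of r vertices and, for every
-- subset U of it, r independent vertices  combine (encode U) c  with neighbourhood U.
module Construction (r : ℕ) where

  open SplitGraph {r} {2 ^ r * r} (λ y → decode (quotient r y)) public

  neighbourhood-copy : ∀ U c → decode {r} (quotient r (combine (encode U) c)) ≡ U
  neighbourhood-copy U c =
    trans (cong (decode ∘ proj₁) (remQuot-combine {k = r} (encode U) c)) (decode-encode U)

  gathering : Gathering graph r
  gathering = record
    { home           = clique
    ; home-injective = ↑ˡ-injective _ _ _
    ; meet           = λ U c → independent (combine (encode U) c)
    ; meet-injective = λ U {c} {c′} same →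
        combine-injectiveʳ (encode U) c (encode U) c′ (↑ʳ-injective r _ _ same)
    ; home-meet      = λ U c {i} i∈U →
        clique-independent (subst (i ∈_) (sym (neighbourhood-copy U c)) i∈U)
    ; meet-neighbour = λ U c w adjacent →
        let i , i∈ , w≡home = independent-neighbour w _ adjacent
        in  i , subst (i ∈_) (neighbourhood-copy U c) i∈ , w≡home
    }

proposition3p5 : (r m : ℕ) → 1 ≤ m → m ≤ r →
    Σ ℕ λ n → Σ (Graph n) λ G →
    IsSplit G × n ≥ r ∸ m + 1 × SigmaIs G m r (r ∸ m + 1)
proposition3p5 r m 1≤m m≤r =
  r + 2 ^ r * r , graph , isSplit , ≤-trans k≤r (m≤m+n r _) ,
  (shadowing default k≤r , shadowing-wins graph default k≤r r∸k<m) ,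
  (λ s s<k → gathering-beats-spies gathering 1≤m (m≤r∸s s<k))
  where
  open Construction r
  open ≤-Reasoning

  k : ℕ
  k = r ∸ m + 1

  k≤r : k ≤ r
  k≤r = ≤-trans (+-monoʳ-≤ (r ∸ m) 1≤m) (≤-reflexive (m∸n+n≡m m≤r))

  default : Config (r + 2 ^ r * r) k
  default j = clique (inject≤ j k≤r)

  r∸k<m : r ∸ k < m
  r∸k<m = begin-strict
    r ∸ (r ∸ m + 1)  ≡⟨ sym (∸-+-assoc r (r ∸ m) 1) ⟩
    r ∸ (r ∸ m) ∸ 1  ≡⟨ cong (_∸ 1) (m∸[m∸n]≡n m≤r) ⟩
    m ∸ 1            <⟨ ∸-monoʳ-< (s≤s z≤n) 1≤m ⟩
    m                ∎

  m≤r∸s : ∀ {s} → s < k → m ≤ r ∸ s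
  m≤r∸s {s} s<k = begin
    m            ≡⟨ sym (m∸[m∸n]≡n m≤r) ⟩
    r ∸ (r ∸ m)  ≤⟨ ∸-monoʳ-≤ r (m<1+n⇒m≤n (subst (s <_) (+-comm (r ∸ m) 1) s<k)) ⟩
    r ∸ s        ∎
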